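{- Let $n\ge1$ and $M\in A(3,n)$. Let $x,y,z,w$ be the numbers of columns of $M$ whose first two entries are $(1,1)$, $(-1,-1)$, $(1,-1)$, $(-1,1)$ respectively, and let $u$ (resp. $v$) be the number of columns whose first two entries sum to $0$ and whose third entry is $1$ (resp. $-1$). If $n$ is even, then $x=y$ and $z=w=u=v$. If $n$ is odd, then $$(x-y,\,z-w,\,u-v)\in\{(0,1,1),(0,-1,-1),(0,1,-1),(0,-1,1),(1,0,0),(-1,0,0),(1,0,2),(-1,0,-2)\}.$$
   Context: For positive integers $m,n$, let $A(m,n)$ be the set of all $m\times n$ matrices with every entry in $\{1,-1\}$ such that every row sum and every column sum has absolute value at most $1$. -}

module Defs where

open import Data.Nat using (ℕ; zero; suc)
open import Data.Integer using (ℤ; +_; -_; _+_; ∣_∣)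
open import Data.Fin using (Fin; zero; suc)
open import Data.Bool using (Bool; true; false; _∧_)
open import Data.Product using (_×_)
open import Data.Sum using (_⊎_)
open import Relation.Binary.PropositionalEquality using (_≡_)
open import Relation.Nullary.Decidable using (⌊_⌋)
import Data.Nat as ℕ
import Data.Integer as ℤ

Matrix : ℕ → ℕ → Set
Matrix m n = Fin m → Fin n → ℤ

sumFin : ∀ n → (Fin n → ℤ) → ℤ
sumFin zero    f = + 0
sumFin (suc n) f = f zero + sumFin n (λ j → f (suc j))

count : ∀ n → (Fin n → Bool) → ℕ
count zero    p = 0
count (suc n) p = (if p zero then 1 else 0) ℕ.+ count n (λ j → p (suc j))
  where open import Data.Bool using (if_then_else_)

rowSum : ∀ {m n} → Matrix m n → Fin m → ℤ
rowSum {m} {n} M i = sumFin n (λ j → M i j)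

colSum : ∀ {m n} → Matrix m n → Fin n → ℤ
colSum {m} {n} M j = sumFin m (λ i → M i j)

InA : ∀ m n → Matrix m n → Set
InA m n M =
  (∀ i j → M i j ≡ + 1 ⊎ M i j ≡ - (+ 1)) ×
  (∀ i → ∣ rowSum M i ∣ ℕ.≤ 1) ×
  (∀ j → ∣ colSum M j ∣ ℕ.≤ 1)

infix 4 _==_
_==_ : ℤ → ℤ → Bool
a == b = ⌊ a ℤ.≟ b ⌋

r0 r1 r2 : Fin 3
r0 = zero
r1 = suc zero
r2 = suc (suc zero)

cntX cntY cntZ cntW cntU cntV : ∀ n → Matrix 3 n → ℕ
cntX n M = count n (λ j → (M r0 j == + 1) ∧ (M r1 j == + 1))
cntY n M = count n (λ j → (M r0 j == - (+ 1)) ∧ (M r1 j == - (+ 1)))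
cntZ n M = count n (λ j → (M r0 j == + 1) ∧ (M r1 j == - (+ 1)))
cntW n M = count n (λ j → (M r0 j == - (+ 1)) ∧ (M r1 j == + 1))
cntU n M = count n (λ j → ((M r0 j + M r1 j) == + 0) ∧ (M r2 j == + 1))
cntV n M = count n (λ j → ((M r0 j + M r1 j) == + 0) ∧ (M r2 j == - (+ 1)))

module Submission where

-- Let M be a 3 × n matrix with entries ±1 and all row and column sums in
-- {-1, 0, 1}, and write d = x - y, e = z - w, f = u - v for the differences
-- of the column-pattern counts.  A column with sum in {-1, 0, 1} is never
-- constant, so its third entry is forced (-1 below (1,1), 1 below (-1,-1))
-- unless its first two entries differ.  Hence every column satisfies a small
-- linear system (RowSystem) relating its entries to the indicators of the
-- six patterns, and since the system is closed under addition, summing over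
-- the columns gives the same system for the row sums R₀, R₁, R₂ and counts:
--   R₀ = d + e,  R₁ = d - e,  R₂ = f - d,  n = x + y + z + w,  u + v = z + w.
-- Consequently n, R₀, R₁, R₂ all have the same parity.  A row sum lies in
-- {-1, 0, 1}, so it is 0 when even and ±1 when odd.  For even n all row sums
-- vanish and the system forces x = y, z = w = u = v; for odd n all row sums
-- are ±1, and solving 2d = R₀ + R₁, 2e = R₀ - R₁, f = R₂ + d in the eight
-- sign cases yields exactly the eight listed triples (d, e, f).

open import Defs
open import Data.Nat using (ℕ; _≤_; s≤s)
import Data.Nat as ℕ
open import Data.Nat.Divisibility using (_∣_; ∣1⇒≡1)
open import Data.Integer using (ℤ; +_; -_; -[1+_]; _-_; _+_; _*_; ∣_∣; _≟_)
open import Data.Integer.Properties using (+-injective; i-j≡0⇒i≡j; *-cancelʳ-≡)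
open import Data.Integer.Tactic.RingSolver using (solve-∀)
import Data.Integer.Divisibility.Signed as Signed
open import Data.Bool using (Bool; _∧_; if_then_else_)
open import Data.Fin using (Fin; zero; suc)
open import Data.Product using (Σ; _×_; _,_)
open import Data.Product.Properties using (≡-dec)
open import Data.Sum using (_⊎_; inj₁; inj₂)
open import Data.Empty using (⊥-elim)
open import Data.List using (List; _∷_; [])
open import Data.List.Membership.Propositional using (_∈_)
open import Data.List.Membership.DecPropositional (≡-dec _≟_ (≡-dec _≟_ _≟_)) using (_∈?_)
open import Relation.Binary.PropositionalEquality
  using (_≡_; refl; sym; trans; cong; cong₂; module ≡-Reasoning)
open import Relation.Nullary using (¬_)
open import Relation.Nullary.Decidable using (True; toWitness)

open ≡-Reasoning

χ : Bool → ℤ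
χ b = + (if b then 1 else 0)

isX isY isZ isW : ℤ → ℤ → Bool
isX a b = (a == + 1) ∧ (b == + 1)
isY a b = (a == - (+ 1)) ∧ (b == - (+ 1))
isZ a b = (a == + 1) ∧ (b == - (+ 1))
isW a b = (a == - (+ 1)) ∧ (b == + 1)

isU isV : ℤ → ℤ → ℤ → Bool
isU a b c = ((a + b) == + 0) ∧ (c == + 1)
isV a b c = ((a + b) == + 0) ∧ (c == - (+ 1))

PlusMinusOne : ℤ → Set
PlusMinusOne a = a ≡ + 1 ⊎ a ≡ - (+ 1)

record RowSystem (r₀ r₁ r₂ x y z w u v n : ℤ) : Set where
  constructor rowSystem
  field
    row₀  : r₀ ≡ (x - y) + (z - w)
    row₁  : r₁ ≡ (x - y) - (z - w)
    row₂  : r₂ ≡ (u - v) - (x - y)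
    size  : n ≡ x + y + z + w
    split : u + v ≡ z + w

-- A single ±1 column whose sum (written as sumFin 3 computes it) lies in
-- {-1, 0, 1} satisfies the system with its pattern indicators and n = 1.
column : ∀ {a b c} → PlusMinusOne a → PlusMinusOne b → PlusMinusOne c →
  ∣ a + (b + (c + + 0)) ∣ ≤ 1 →
  RowSystem a b c (χ (isX a b)) (χ (isY a b)) (χ (isZ a b)) (χ (isW a b))
    (χ (isU a b c)) (χ (isV a b c)) (+ 1)
column (inj₁ refl) (inj₁ refl) (inj₁ refl) (s≤s ())
column (inj₁ refl) (inj₁ refl) (inj₂ refl) _ = rowSystem refl refl refl refl refl
column (inj₁ refl) (inj₂ refl) (inj₁ refl) _ = rowSystem refl refl refl refl refl
column (inj₁ refl) (inj₂ refl) (inj₂ refl) _ = rowSystem refl refl refl refl refl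
column (inj₂ refl) (inj₁ refl) (inj₁ refl) _ = rowSystem refl refl refl refl refl
column (inj₂ refl) (inj₁ refl) (inj₂ refl) _ = rowSystem refl refl refl refl refl
column (inj₂ refl) (inj₂ refl) (inj₁ refl) _ = rowSystem refl refl refl refl refl
column (inj₂ refl) (inj₂ refl) (inj₂ refl) (s≤s ())

system-+ : ∀ {r₀ r₁ r₂ x y z w u v n r₀′ r₁′ r₂′ x′ y′ z′ w′ u′ v′ n′} →
  RowSystem r₀ r₁ r₂ x y z w u v n → RowSystem r₀′ r₁′ r₂′ x′ y′ z′ w′ u′ v′ n′ →
  RowSystem (r₀ + r₀′) (r₁ + r₁′) (r₂ + r₂′) (x + x′) (y + y′) (z + z′) (w + w′)
    (u + u′) (v + v′) (n + n′)
system-+ {x = x} {y} {z} {w} {u} {v} {x′ = x′} {y′} {z′} {w′} {u′} {v′} s t = rowSystem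
  (trans (cong₂ _+_ (row₀ s) (row₀ t)) (plus-plus x y z w x′ y′ z′ w′))
  (trans (cong₂ _+_ (row₁ s) (row₁ t)) (minus-minus x y z w x′ y′ z′ w′))
  (trans (cong₂ _+_ (row₂ s) (row₂ t)) (minus-minus u v x y u′ v′ x′ y′))
  (trans (cong₂ _+_ (size s) (size t)) (sum-sum x y z w x′ y′ z′ w′))
  (trans (pair-pair u v u′ v′) (trans (cong₂ _+_ (split s) (split t)) (sym (pair-pair z w z′ w′))))
  where
  open RowSystem
  plus-plus : ∀ a b c d a′ b′ c′ d′ → ((a - b) + (c - d)) + ((a′ - b′) + (c′ - d′))
    ≡ ((a + a′) - (b + b′)) + ((c + c′) - (d + d′))
  plus-plus = solve-∀
  minus-minus : ∀ a b c d a′ b′ c′ d′ → ((a - b) - (c - d)) + ((a′ - b′) - (c′ - d′))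
    ≡ ((a + a′) - (b + b′)) - ((c + c′) - (d + d′))
  minus-minus = solve-∀
  sum-sum : ∀ a b c d a′ b′ c′ d′ → (a + b + c + d) + (a′ + b′ + c′ + d′)
    ≡ (a + a′) + (b + b′) + (c + c′) + (d + d′)
  sum-sum = solve-∀
  pair-pair : ∀ a b a′ b′ → (a + a′) + (b + b′) ≡ (a + b) + (a′ + b′)
  pair-pair = solve-∀

system-count : ∀ n {r₀ r₁ r₂ : Fin n → ℤ} {px py pz pw pu pv : Fin n → Bool} →
  (∀ j → RowSystem (r₀ j) (r₁ j) (r₂ j) (χ (px j)) (χ (py j)) (χ (pz j)) (χ (pw j))
           (χ (pu j)) (χ (pv j)) (+ 1)) →
  RowSystem (sumFin n r₀) (sumFin n r₁) (sumFin n r₂)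
    (+ count n px) (+ count n py) (+ count n pz) (+ count n pw)
    (+ count n pu) (+ count n pv) (+ n)
system-count ℕ.zero _ = rowSystem refl refl refl refl refl
system-count (ℕ.suc n) cols = system-+ (cols zero) (system-count n (λ j → cols (suc j)))

matrixSystem : ∀ n (M : Matrix 3 n) → (∀ i j → PlusMinusOne (M i j)) →
  (∀ j → ∣ colSum M j ∣ ≤ 1) →
  RowSystem (rowSum M r0) (rowSum M r1) (rowSum M r2)
    (+ cntX n M) (+ cntY n M) (+ cntZ n M) (+ cntW n M) (+ cntU n M) (+ cntV n M) (+ n)
matrixSystem n M entries colBound =
  system-count n (λ j → column (entries r0 j) (entries r1 j) (entries r2 j) (colBound j))

Even : ℤ → Set
Even r = + 2 Signed.∣ r

SameParity : ℤ → ℤ → Set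
SameParity a b = Σ ℤ λ k → a ≡ b + k * + 2

parity-even : ∀ {a b} → SameParity a b → Even a → Even b
parity-even (k , refl) 2∣a = Signed.∣m+n∣n⇒∣m 2∣a (Signed.divides k refl)

parity-even⁻ : ∀ {a b} → SameParity a b → Even b → Even a
parity-even⁻ (k , refl) 2∣b = Signed.∣m∣n⇒∣m+n 2∣b (Signed.divides k refl)

double-injective : ∀ i j → i + i ≡ j + j → i ≡ j
double-injective i j eq = *-cancelʳ-≡ i j (+ 2) (trans (sym (double i)) (trans eq (double j)))
  where
  double : ∀ k → k + k ≡ k * + 2
  double = solve-∀

module Consequences {r₀ r₁ r₂ x y z w u v n : ℤ}
                    (s : RowSystem r₀ r₁ r₂ x y z w u v n) where
  open RowSystem s

  size-parity : SameParity n r₀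
  size-parity = y + w , (begin
    n                                       ≡⟨ size ⟩
    x + y + z + w                           ≡⟨ regroup x y z w ⟩
    ((x - y) + (z - w)) + (y + w) * + 2     ≡⟨ cong (_+ (y + w) * + 2) (sym row₀) ⟩
    r₀ + (y + w) * + 2                      ∎)
    where
    regroup : ∀ a b c d → a + b + c + d ≡ ((a - b) + (c - d)) + (b + d) * + 2
    regroup = solve-∀

  rows-parity : SameParity r₀ r₁
  rows-parity = z - w , (begin
    r₀                                      ≡⟨ row₀ ⟩
    (x - y) + (z - w)                       ≡⟨ regroup x y z w ⟩
    ((x - y) - (z - w)) + (z - w) * + 2     ≡⟨ cong (_+ (z - w) * + 2) (sym row₁) ⟩
    r₁ + (z - w) * + 2                      ∎)
    where
    regroup : ∀ a b c d → (a - b) + (c - d) ≡ ((a - b) - (c - d)) + (c - d) * + 2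
    regroup = solve-∀

  -- uses u + v = z + w to trade u for z + w - v
  last-parity : SameParity r₁ r₂
  last-parity = k , (begin
    r₁                                      ≡⟨ row₁ ⟩
    (x - y) - (z - w)                       ≡⟨ regroup x y z w u v ⟩
    main + ((z + w) - (u + v))              ≡⟨ cong (λ t → main + (t - (u + v))) (sym split) ⟩
    main + ((u + v) - (u + v))              ≡⟨ cancel main (u + v) ⟩
    ((u - v) - (x - y)) + k * + 2           ≡⟨ cong (_+ k * + 2) (sym row₂) ⟩
    r₂ + k * + 2                            ∎)
    where
    k main : ℤ
    k = x - y - z + v
    main = ((u - v) - (x - y)) + k * + 2
    regroup : ∀ a b c d e f → (a - b) - (c - d)
      ≡ (((e - f) - (a - b)) + (a - b - c + f) * + 2) + ((c + d) - (e + f))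
    regroup = solve-∀
    cancel : ∀ a b → a + (b - b) ≡ a
    cancel = solve-∀

  solved-d : (x - y) + (x - y) ≡ r₀ + r₁
  solved-d = trans (identity x y z w) (sym (cong₂ _+_ row₀ row₁))
    where
    identity : ∀ a b c d → (a - b) + (a - b) ≡ ((a - b) + (c - d)) + ((a - b) - (c - d))
    identity = solve-∀

  solved-e : (z - w) + (z - w) ≡ r₀ - r₁
  solved-e = trans (identity x y z w) (sym (cong₂ _-_ row₀ row₁))
    where
    identity : ∀ a b c d → (c - d) + (c - d) ≡ ((a - b) + (c - d)) - ((a - b) - (c - d))
    identity = solve-∀

  solved-f : u - v ≡ r₂ + (x - y)
  solved-f = trans (identity u v x y) (cong (_+ (x - y)) (sym row₂))
    where
    identity : ∀ a b c d → a - b ≡ ((a - b) - (c - d)) + (c - d)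
    identity = solve-∀

open Consequences

two∤one : ¬ (2 ∣ 1)
two∤one 2∣1 with () ← ∣1⇒≡1 2∣1

small-even : ∀ {r} → ∣ r ∣ ≤ 1 → Even r → r ≡ + 0
small-even {+ 0}                _        _  = refl
small-even {+ 1}                _        2∣r = ⊥-elim (two∤one (Signed.∣⇒∣ᵤ 2∣r))
small-even {+ ℕ.suc (ℕ.suc _)}  (s≤s ()) _
small-even { -[1+ 0 ]}          _        2∣r = ⊥-elim (two∤one (Signed.∣⇒∣ᵤ 2∣r))
small-even { -[1+ ℕ.suc _ ]}    (s≤s ()) _

small-odd : ∀ {r} → ∣ r ∣ ≤ 1 → ¬ Even r → PlusMinusOne r
small-odd {+ 0}                _        odd = ⊥-elim (odd (Signed.divides (+ 0) refl))
small-odd {+ 1}                _        _   = inj₁ refl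
small-odd {+ ℕ.suc (ℕ.suc _)}  (s≤s ()) _
small-odd { -[1+ 0 ]}          _        _   = inj₂ refl
small-odd { -[1+ ℕ.suc _ ]}    (s≤s ()) _

even-counts : ∀ {r₀ r₁ r₂ x y z w u v n} → r₀ ≡ + 0 → r₁ ≡ + 0 → r₂ ≡ + 0 →
  RowSystem r₀ r₁ r₂ (+ x) (+ y) (+ z) (+ w) (+ u) (+ v) n →
  x ≡ y × z ≡ w × w ≡ u × u ≡ v
even-counts {x = x} {y} {z} {w} {u} {v} refl refl refl s = x≡y , z≡w , w≡u , u≡v
  where
  difference-zero : ∀ {a b} → + a - + b ≡ + 0 → a ≡ b
  difference-zero {a} {b} eq = +-injective (i-j≡0⇒i≡j (+ a) (+ b) eq)
  d≡0 : + x - + y ≡ + 0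
  d≡0 = double-injective (+ x - + y) (+ 0) (solved-d s)
  x≡y : x ≡ y
  x≡y = difference-zero d≡0
  z≡w : z ≡ w
  z≡w = difference-zero (double-injective (+ z - + w) (+ 0) (solved-e s))
  u≡v : u ≡ v
  u≡v = difference-zero (trans (solved-f s) (cong (_+_ (+ 0)) d≡0))
  w≡u : w ≡ u
  w≡u = +-injective (double-injective (+ w) (+ u) (begin
    + w + + w   ≡⟨ cong (λ t → + t + + w) (sym z≡w) ⟩
    + z + + w   ≡⟨ sym (RowSystem.split s) ⟩
    + u + + v   ≡⟨ cong (λ t → + u + + t) (sym u≡v) ⟩
    + u + + u   ∎))

oddTriples : List (ℤ × ℤ × ℤ)
oddTriples = (+ 0 , + 1 , + 1) ∷ (+ 0 , - (+ 1) , - (+ 1)) ∷ (+ 0 , + 1 , - (+ 1)) ∷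
             (+ 0 , - (+ 1) , + 1) ∷ (+ 1 , + 0 , + 0) ∷ (- (+ 1) , + 0 , + 0) ∷
             (+ 1 , + 0 , + 2) ∷ (- (+ 1) , + 0 , - (+ 2)) ∷ []

listed : ∀ {t} {listed? : True (t ∈? oddTriples)} → t ∈ oddTriples
listed {listed? = p} = toWitness p

odd-triple : ∀ {r₀ r₁ r₂ d e f} → PlusMinusOne r₀ → PlusMinusOne r₁ → PlusMinusOne r₂ →
  d + d ≡ r₀ + r₁ → e + e ≡ r₀ - r₁ → f ≡ r₂ + d → (d , e , f) ∈ oddTriples
odd-triple {d = d} {e} (inj₁ refl) (inj₁ refl) (inj₁ refl) hd he refl
  rewrite double-injective d (+ 1) hd | double-injective e (+ 0) he = listed
odd-triple {d = d} {e} (inj₁ refl) (inj₁ refl) (inj₂ refl) hd he refl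
  rewrite double-injective d (+ 1) hd | double-injective e (+ 0) he = listed
odd-triple {d = d} {e} (inj₁ refl) (inj₂ refl) (inj₁ refl) hd he refl
  rewrite double-injective d (+ 0) hd | double-injective e (+ 1) he = listed
odd-triple {d = d} {e} (inj₁ refl) (inj₂ refl) (inj₂ refl) hd he refl
  rewrite double-injective d (+ 0) hd | double-injective e (+ 1) he = listed
odd-triple {d = d} {e} (inj₂ refl) (inj₁ refl) (inj₁ refl) hd he refl
  rewrite double-injective d (+ 0) hd | double-injective e (- (+ 1)) he = listed
odd-triple {d = d} {e} (inj₂ refl) (inj₁ refl) (inj₂ refl) hd he refl
  rewrite double-injective d (+ 0) hd | double-injective e (- (+ 1)) he = listed
odd-triple {d = d} {e} (inj₂ refl) (inj₂ refl) (inj₁ refl) hd he refl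
  rewrite double-injective d (- (+ 1)) hd | double-injective e (+ 0) he = listed
odd-triple {d = d} {e} (inj₂ refl) (inj₂ refl) (inj₂ refl) hd he refl
  rewrite double-injective d (- (+ 1)) hd | double-injective e (+ 0) he = listed

lemma1 : ∀ (n : ℕ) → 1 ≤ n → (M : Matrix 3 n) → InA 3 n M →
  (2 ∣ n →
    cntX n M ≡ cntY n M × cntZ n M ≡ cntW n M ×
    cntW n M ≡ cntU n M × cntU n M ≡ cntV n M) ×
  (¬ (2 ∣ n) →
    ((+ cntX n M - + cntY n M) , (+ cntZ n M - + cntW n M) , (+ cntU n M - + cntV n M))
      ∈ ((+ 0 , + 1 , + 1) ∷ (+ 0 , - (+ 1) , - (+ 1)) ∷ (+ 0 , + 1 , - (+ 1)) ∷
         (+ 0 , - (+ 1) , + 1) ∷ (+ 1 , + 0 , + 0) ∷ (- (+ 1) , + 0 , + 0) ∷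
         (+ 1 , + 0 , + 2) ∷ (- (+ 1) , + 0 , - (+ 2)) ∷ []))
lemma1 n _ M (entries , rowBound , colBound) = evenCase , oddCase
  where
  s : RowSystem (rowSum M r0) (rowSum M r1) (rowSum M r2) (+ cntX n M) (+ cntY n M)
        (+ cntZ n M) (+ cntW n M) (+ cntU n M) (+ cntV n M) (+ n)
  s = matrixSystem n M entries colBound

  evenCase : 2 ∣ n →
    cntX n M ≡ cntY n M × cntZ n M ≡ cntW n M × cntW n M ≡ cntU n M × cntU n M ≡ cntV n M
  evenCase 2∣n = even-counts (small-even (rowBound r0) 2∣R₀) (small-even (rowBound r1) 2∣R₁)
                             (small-even (rowBound r2) 2∣R₂) s
    where
    2∣R₀ : Even (rowSum M r0)
    2∣R₀ = parity-even (size-parity s) (Signed.∣ᵤ⇒∣ 2∣n)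
    2∣R₁ : Even (rowSum M r1)
    2∣R₁ = parity-even (rows-parity s) 2∣R₀
    2∣R₂ : Even (rowSum M r2)
    2∣R₂ = parity-even (last-parity s) 2∣R₁

  oddCase : ¬ (2 ∣ n) → (+ cntX n M - + cntY n M , + cntZ n M - + cntW n M , + cntU n M - + cntV n M)
    ∈ oddTriples
  oddCase 2∤n = odd-triple (small-odd (rowBound r0) 2∤R₀) (small-odd (rowBound r1) 2∤R₁)
                           (small-odd (rowBound r2) 2∤R₂) (solved-d s) (solved-e s) (solved-f s)
    where
    2∤R₀ : ¬ Even (rowSum M r0)
    2∤R₀ = λ 2∣R₀ → 2∤n (Signed.∣⇒∣ᵤ (parity-even⁻ (size-parity s) 2∣R₀))
    2∤R₁ : ¬ Even (rowSum M r1)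
    2∤R₁ = λ 2∣R₁ → 2∤R₀ (parity-even⁻ (rows-parity s) 2∣R₁)
    2∤R₂ : ¬ Even (rowSum M r2)
    2∤R₂ = λ 2∣R₂ → 2∤R₁ (parity-even⁻ (last-parity s) 2∣R₂)
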